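{- Let $M$ be any map with a single zigzag, with Gauss code $\overline{P}$ over the edge set $E$ and interlace function $i_{\overline{P}}$. Then for every $x\in E$, $b_P(x)=i_{\overline{P}}^2(x)+s_x(i_{\overline{P}}(x))$.
   Context: A map $M$ is a graph $G_M$ with edge set $E=\{1,\dots,n\}$ cellularly embedded in a closed surface. $M$ has a single zigzag if there is a single closed walk which alternately takes the leftmost and rightmost continuation at each vertex; it traverses each edge exactly twice, and the cyclic sequence of traversed edges is the Gauss code $\overline{P}$. An edge is black if the zigzag traverses it twice in the same direction, white otherwise. Identify subsets of $E$ with vectors in $\mathbb{Z}_2^E$ (addition = symmetric difference) and $x$ with $\{x\}$. Define linear maps by their values on singletons: $i_{\overline{P}}(x)$ = set of edges occurring exactly once in the cyclic sequence $\overline{P}$ strictly between the two occurrences of $x$; $\kappa_P(x)=\{x\}$ if $x$ is black, $\emptyset$ if white. Put $c_P=\kappa_P+i_{\overline{P}}$, $c_{P^\sim}=c_P+\mathrm{id}$, $b_P=c_{P^\sim}\circ c_P$. For $e\in E$ and $A\subseteq E$, $s_e(A)$ is the set of elements of $A$ having the same colour (black/white) as $e$. -}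

module Defs where

open import Data.Bool using (Bool; true; false; if_then_else_; _xor_; _∧_; not)
open import Data.Nat using (ℕ; _≡ᵇ_)
open import Data.Fin using (Fin; _≟_)
open import Data.Fin.Subset using (Subset; ⁅_⁆; ⊥)
open import Data.List using (List; []; _∷_; length; allFin; foldr)
open import Data.Vec using (zipWith; tabulate; lookup)
open import Data.Product using (_×_; _,_)
open import Relation.Nullary using (yes; no)
open import Relation.Binary.PropositionalEquality using (_≡_)

-- A traversal of an edge by the zigzag: (edge, direction relative to a fixed
-- reference orientation of that edge).
Dart : ℕ → Set
Dart n = Fin n × Bool

-- The zigzag, read as a linear representative of the cyclic sequence of
-- traversed edges (with traversal directions).  Edge set E = Fin n.
Zigzag : ℕ → Set
Zigzag n = List (Dart n)

occs : ∀ {n} → Fin n → Zigzag n → List Bool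
occs x [] = []
occs x ((y , d) ∷ w) with y ≟ x
... | yes _ = d ∷ occs x w
... | no  _ = occs x w

IsGaussCode : ∀ {n} → Zigzag n → Set
IsGaussCode {n} w = (x : Fin n) → length (occs x w) ≡ 2

black : ∀ {n} → Zigzag n → Fin n → Bool
black w x with occs x w
... | d₁ ∷ d₂ ∷ _ = not (d₁ xor d₂)
... | _ = false

after : ∀ {n} → Fin n → Zigzag n → Zigzag n
after x [] = []
after x ((y , d) ∷ w) with y ≟ x
... | yes _ = w
... | no  _ = after x w

before : ∀ {n} → Fin n → Zigzag n → Zigzag n
before x [] = []
before x ((y , d) ∷ w) with y ≟ x
... | yes _ = []
... | no  _ = (y , d) ∷ before x w

segment : ∀ {n} → Fin n → Zigzag n → Zigzag n
segment x w = before x (after x w)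

_⊕_ : ∀ {n} → Subset n → Subset n → Subset n
_⊕_ = zipWith _xor_

infixl 6 _⊕_

-- linear extension of a map given on singletons
extend : ∀ {n} → (Fin n → Subset n) → Subset n → Subset n
extend {n} f A = foldr (λ x acc → if lookup A x then f x ⊕ acc else acc) ⊥ (allFin n)

iP : ∀ {n} → Zigzag n → Subset n → Subset n
iP w = extend (λ x → tabulate (λ y → length (occs y (segment x w)) ≡ᵇ 1))

κP : ∀ {n} → Zigzag n → Subset n → Subset n
κP w = extend (λ x → if black w x then ⁅ x ⁆ else ⊥)

cP : ∀ {n} → Zigzag n → Subset n → Subset n
cP w A = κP w A ⊕ iP w A

cP∼ : ∀ {n} → Zigzag n → Subset n → Subset n
cP∼ w A = cP w A ⊕ A

bP : ∀ {n} → Zigzag n → Subset n → Subset n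
bP w A = cP∼ w (cP w A)

s : ∀ {n} → Zigzag n → Fin n → Subset n → Subset n
s w e A = tabulate (λ y → lookup A y ∧ not (black w y xor black w e))

-- Over Z₂, b_P = c_P∼ ∘ c_P = c_P² + c_P.  Since κ_P is the projection onto
-- the black edges (κ_P² = κ_P), expanding c_P = κ_P + i_P gives
-- b_P = i_P² + κ_P i_P + i_P (κ_P + id).  On a singleton, (κ_P + id) x is 0
-- for black x and x for white x, and correspondingly s_x(A) = κ_P A for black
-- x and κ_P A + A for white x.
module Submission where

open import Defs
open import Algebra.Bundles using (CommutativeMonoid)
open import Algebra.Structures using (IsCommutativeMonoid)
import Algebra.Properties.CommutativeSemigroup as CommutativeSemigroupProperties
import Algebra.Solver.CommutativeMonoid as CommutativeMonoidSolver
open import Data.Bool using (Bool; true; false; not; _∧_; _xor_; if_then_else_)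
open import Data.Bool.Properties
  using ( xor-assoc; xor-comm; xor-identityˡ; xor-identityʳ; xor-same
        ; not-distribʳ-xor; ∧-distribˡ-xor; ∧-comm)
open import Data.Fin using (Fin; zero; suc)
open import Data.Fin.Subset using (Subset; ⁅_⁆; ⊥; _∩_)
open import Data.Fin.Subset.Properties using (∩-assoc; ∩-idem)
import Data.List as List
open import Data.Nat using (ℕ; suc)
open import Data.Product using (_,_)
open import Data.Vec using ([]; _∷_; tabulate; lookup)
open import Data.Vec.Properties
  using (zipWith-assoc; zipWith-comm; zipWith-identityˡ; zipWith-identityʳ; tabulate∘lookup)
open import Level using (0ℓ)
open import Relation.Binary.PropositionalEquality
  using (_≡_; refl; sym; trans; cong; cong₂; module ≡-Reasoning)
open import Relation.Binary.PropositionalEquality.Algebra using (isMagma)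

private
  variable
    n m : ℕ

⊕-assoc : (A B C : Subset n) → A ⊕ B ⊕ C ≡ A ⊕ (B ⊕ C)
⊕-assoc = zipWith-assoc xor-assoc

⊕-comm : (A B : Subset n) → A ⊕ B ≡ B ⊕ A
⊕-comm = zipWith-comm xor-comm

⊕-identityˡ : (A : Subset n) → ⊥ ⊕ A ≡ A
⊕-identityˡ = zipWith-identityˡ xor-identityˡ

⊕-identityʳ : (A : Subset n) → A ⊕ ⊥ ≡ A
⊕-identityʳ = zipWith-identityʳ xor-identityʳ

⊕-self : (A : Subset n) → A ⊕ A ≡ ⊥
⊕-self []      = refl
⊕-self (a ∷ A) = cong₂ _∷_ (xor-same a) (⊕-self A)

⊕-isCommutativeMonoid : IsCommutativeMonoid _≡_ (_⊕_ {n}) ⊥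
⊕-isCommutativeMonoid = record
  { isMonoid = record
    { isSemigroup = record { isMagma = isMagma _⊕_ ; assoc = ⊕-assoc }
    ; identity    = ⊕-identityˡ , ⊕-identityʳ
    }
  ; comm = ⊕-comm
  }

⊕-commutativeMonoid : ℕ → CommutativeMonoid 0ℓ 0ℓ
⊕-commutativeMonoid n = record { isCommutativeMonoid = ⊕-isCommutativeMonoid {n} }

infixr 7 _·_

_·_ : Bool → Subset n → Subset n
a · A = if a then A else ⊥

·-distribʳ-xor : (a b : Bool) (A : Subset n) → (a xor b) · A ≡ a · A ⊕ b · A
·-distribʳ-xor true  true  A = sym (⊕-self A)
·-distribʳ-xor true  false A = sym (⊕-identityʳ A)
·-distribʳ-xor false b     A = sym (⊕-identityˡ (b · A))

·-⊕-self : (a : Bool) (A : Subset n) → a · A ⊕ A ≡ not a · A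
·-⊕-self true  A = ⊕-self A
·-⊕-self false A = ⊕-identityˡ A

if-⊕ : (a : Bool) (A B : Subset n) → (if a then A ⊕ B else B) ≡ a · A ⊕ B
if-⊕ true  A B = refl
if-⊕ false A B = sym (⊕-identityˡ B)

·-false∷ : (a : Bool) (A : Subset n) → a · (false ∷ A) ≡ false ∷ a · A
·-false∷ true  A = refl
·-false∷ false A = refl

·-·-⁅zero⁆-⊕ : (a b : Bool) (A : Subset n) → a · b · ⁅ zero ⁆ ⊕ (false ∷ A) ≡ (a ∧ b) ∷ A
·-·-⁅zero⁆-⊕ true  true  A = cong (true ∷_) (⊕-identityˡ A)
·-·-⁅zero⁆-⊕ true  false A = cong (false ∷_) (⊕-identityˡ A)
·-·-⁅zero⁆-⊕ false b     A = cong (false ∷_) (⊕-identityˡ A)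

-- extend cannot recurse on its argument, since its codomain is tied to the
-- index set; lincomb can.
lincomb : (Fin n → Subset m) → Subset n → Subset m
lincomb f []      = ⊥
lincomb f (a ∷ A) = a · f zero ⊕ lincomb (λ x → f (suc x)) A

extend-lincomb : (f : Fin n → Subset n) (A : Subset n) → extend f A ≡ lincomb f A
extend-lincomb {n} f A = trans (foldr-tabulate (λ x → x) A) (cong (lincomb f) (tabulate∘lookup A))
  where
  foldr-tabulate : ∀ {k} (g : Fin k → Fin n) (A : Subset n) →
    List.foldr (λ x acc → if lookup A x then f x ⊕ acc else acc) ⊥ (List.tabulate g)
      ≡ lincomb (λ x → f (g x)) (tabulate (λ x → lookup A (g x)))
  foldr-tabulate {k = 0}     g A = refl
  foldr-tabulate {k = suc k} g A =
    trans (cong (λ R → if a then f (g zero) ⊕ R else R) (foldr-tabulate (λ x → g (suc x)) A))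
          (if-⊕ a (f (g zero)) _)
    where
    a : Bool
    a = lookup A (g zero)

lincomb-cong : {f g : Fin n → Subset m} → (∀ x → f x ≡ g x) → (A : Subset n) → lincomb f A ≡ lincomb g A
lincomb-cong f≗g []      = refl
lincomb-cong f≗g (a ∷ A) = cong₂ (λ B C → a · B ⊕ C) (f≗g zero) (lincomb-cong (λ x → f≗g (suc x)) A)

lincomb-⊥ : (f : Fin n → Subset m) → lincomb f ⊥ ≡ ⊥
lincomb-⊥ {n = 0}     f = refl
lincomb-⊥ {n = suc n} f = trans (⊕-identityˡ _) (lincomb-⊥ (λ x → f (suc x)))

lincomb-⊕ : (f : Fin n → Subset m) (A B : Subset n) → lincomb f (A ⊕ B) ≡ lincomb f A ⊕ lincomb f B
lincomb-⊕ f []      []      = sym (⊕-identityˡ ⊥)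
lincomb-⊕ f (a ∷ A) (b ∷ B) = begin
  (a xor b) · f zero ⊕ lincomb f′ (A ⊕ B)
    ≡⟨ cong₂ _⊕_ (·-distribʳ-xor a b (f zero)) (lincomb-⊕ f′ A B) ⟩
  (a · f zero ⊕ b · f zero) ⊕ (lincomb f′ A ⊕ lincomb f′ B)
    ≡⟨ interchange (a · f zero) _ _ _ ⟩
  (a · f zero ⊕ lincomb f′ A) ⊕ (b · f zero ⊕ lincomb f′ B) ∎
  where
  open ≡-Reasoning
  open CommutativeSemigroupProperties (CommutativeMonoid.commutativeSemigroup (⊕-commutativeMonoid _))
  f′ : Fin _ → Subset _
  f′ x = f (suc x)

lincomb-⁅⁆ : (f : Fin n → Subset m) (x : Fin n) → lincomb f ⁅ x ⁆ ≡ f x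
lincomb-⁅⁆ f zero    = trans (cong (f zero ⊕_) (lincomb-⊥ (λ y → f (suc y)))) (⊕-identityʳ (f zero))
lincomb-⁅⁆ f (suc x) = trans (⊕-identityˡ _) (lincomb-⁅⁆ (λ y → f (suc y)) x)

lincomb-· : (f : Fin n → Subset m) (a : Bool) (A : Subset n) → lincomb f (a · A) ≡ a · lincomb f A
lincomb-· f true  A = refl
lincomb-· f false A = lincomb-⊥ f

lincomb-false∷ : (f : Fin n → Subset m) (A : Subset n) →
  lincomb (λ x → false ∷ f x) A ≡ false ∷ lincomb f A
lincomb-false∷ f []      = refl
lincomb-false∷ f (a ∷ A) =
  cong₂ _⊕_ (·-false∷ a (f zero)) (lincomb-false∷ (λ x → f (suc x)) A)

lincomb-diagonal : (h : Fin n → Bool) (A : Subset n) → lincomb (λ x → h x · ⁅ x ⁆) A ≡ A ∩ tabulate h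
lincomb-diagonal h []      = refl
lincomb-diagonal h (a ∷ A) = begin
  a · h zero · ⁅ zero ⁆ ⊕ lincomb (λ x → h (suc x) · (false ∷ ⁅ x ⁆)) A
    ≡⟨ cong (_ ⊕_) (lincomb-cong (λ x → ·-false∷ (h (suc x)) ⁅ x ⁆) A) ⟩
  a · h zero · ⁅ zero ⁆ ⊕ lincomb (λ x → false ∷ h (suc x) · ⁅ x ⁆) A
    ≡⟨ cong (_ ⊕_) (lincomb-false∷ _ A) ⟩
  a · h zero · ⁅ zero ⁆ ⊕ (false ∷ lincomb (λ x → h (suc x) · ⁅ x ⁆) A)
    ≡⟨ cong (λ B → _ ⊕ (false ∷ B)) (lincomb-diagonal (λ x → h (suc x)) A) ⟩
  a · h zero · ⁅ zero ⁆ ⊕ (false ∷ A ∩ tabulate (λ x → h (suc x)))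
    ≡⟨ ·-·-⁅zero⁆-⊕ a (h zero) _ ⟩
  (a ∧ h zero) ∷ (A ∩ tabulate (λ x → h (suc x))) ∎
  where open ≡-Reasoning

extend-⊕ : (f : Fin n → Subset n) (A B : Subset n) → extend f (A ⊕ B) ≡ extend f A ⊕ extend f B
extend-⊕ f A B = begin
  extend f (A ⊕ B)              ≡⟨ extend-lincomb f (A ⊕ B) ⟩
  lincomb f (A ⊕ B)             ≡⟨ lincomb-⊕ f A B ⟩
  lincomb f A ⊕ lincomb f B     ≡⟨ sym (cong₂ _⊕_ (extend-lincomb f A) (extend-lincomb f B)) ⟩
  extend f A ⊕ extend f B       ∎
  where open ≡-Reasoning

extend-· : (f : Fin n → Subset n) (a : Bool) (A : Subset n) → extend f (a · A) ≡ a · extend f A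
extend-· f a A = begin
  extend f (a · A)    ≡⟨ extend-lincomb f (a · A) ⟩
  lincomb f (a · A)   ≡⟨ lincomb-· f a A ⟩
  a · lincomb f A     ≡⟨ cong (a ·_) (sym (extend-lincomb f A)) ⟩
  a · extend f A      ∎
  where open ≡-Reasoning

extend-⁅⁆ : (f : Fin n → Subset n) (x : Fin n) → extend f ⁅ x ⁆ ≡ f x
extend-⁅⁆ f x = trans (extend-lincomb f ⁅ x ⁆) (lincomb-⁅⁆ f x)

∧-not-xor : (a b c : Bool) → a ∧ not (b xor c) ≡ (a ∧ b) xor (not c ∧ a)
∧-not-xor a b c = begin
  a ∧ not (b xor c)           ≡⟨ cong (a ∧_) (not-distribʳ-xor b c) ⟩
  a ∧ (b xor not c)           ≡⟨ ∧-distribˡ-xor a b (not c) ⟩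
  (a ∧ b) xor (a ∧ not c)     ≡⟨ cong ((a ∧ b) xor_) (∧-comm a (not c)) ⟩
  (a ∧ b) xor (not c ∧ a)     ∎
  where open ≡-Reasoning

tabulate-∧-xnor : (h : Fin n → Bool) (c : Bool) (A : Subset n) →
  tabulate (λ y → lookup A y ∧ not (h y xor c)) ≡ A ∩ tabulate h ⊕ not c · A
tabulate-∧-xnor h true  []      = refl
tabulate-∧-xnor h false []      = refl
tabulate-∧-xnor h true  (a ∷ A) =
  cong₂ _∷_ (∧-not-xor a (h zero) true) (tabulate-∧-xnor (λ y → h (suc y)) true A)
tabulate-∧-xnor h false (a ∷ A) =
  cong₂ _∷_ (∧-not-xor a (h zero) false) (tabulate-∧-xnor (λ y → h (suc y)) false A)

blackEdges : Zigzag n → Subset n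
blackEdges w = tabulate (black w)

κP-∩ : (w : Zigzag n) (A : Subset n) → κP w A ≡ A ∩ blackEdges w
κP-∩ w A = trans (extend-lincomb _ A) (lincomb-diagonal (black w) A)

κP-idempotent : (w : Zigzag n) (A : Subset n) → κP w (κP w A) ≡ κP w A
κP-idempotent w A = begin
  κP w (κP w A)   ≡⟨ κP-∩ w (κP w A) ⟩
  κP w A ∩ H      ≡⟨ cong (_∩ H) (κP-∩ w A) ⟩
  (A ∩ H) ∩ H     ≡⟨ ∩-assoc A H H ⟩
  A ∩ (H ∩ H)     ≡⟨ cong (A ∩_) (∩-idem H) ⟩
  A ∩ H           ≡⟨ sym (κP-∩ w A) ⟩
  κP w A          ∎
  where
  open ≡-Reasoning
  H : Subset _
  H = blackEdges w

κP-⁅⁆-⊕ : (w : Zigzag n) (x : Fin n) → κP w ⁅ x ⁆ ⊕ ⁅ x ⁆ ≡ not (black w x) · ⁅ x ⁆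
κP-⁅⁆-⊕ w x = trans (cong (_⊕ ⁅ x ⁆) (extend-⁅⁆ _ x)) (·-⊕-self (black w x) ⁅ x ⁆)

s-κP : (w : Zigzag n) (x : Fin n) (A : Subset n) → s w x A ≡ κP w A ⊕ not (black w x) · A
s-κP w x A =
  trans (tabulate-∧-xnor (black w) (black w x) A) (cong (_⊕ not (black w x) · A) (sym (κP-∩ w A)))

Additive : (Subset n → Subset m) → Set
Additive f = ∀ A B → f (A ⊕ B) ≡ f A ⊕ f B

c∼∘c-expansion : (K I : Subset n → Subset n) → Additive K → Additive I → (∀ A → K (K A) ≡ K A) →
  (A : Subset n) →
  K (K A ⊕ I A) ⊕ I (K A ⊕ I A) ⊕ (K A ⊕ I A) ≡ I (I A) ⊕ K (I A) ⊕ I (K A ⊕ A)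
c∼∘c-expansion {n} K I K-⊕ I-⊕ K-idem A = begin
  K (K A ⊕ I A) ⊕ I (K A ⊕ I A) ⊕ (K A ⊕ I A)
    ≡⟨ cong₂ (λ B C → B ⊕ C ⊕ (K A ⊕ I A))
             (trans (K-⊕ (K A) (I A)) (cong (_⊕ K (I A)) (K-idem A))) (I-⊕ (K A) (I A)) ⟩
  K A ⊕ K (I A) ⊕ (I (K A) ⊕ I (I A)) ⊕ (K A ⊕ I A)
    ≡⟨ rearrange (K A) (K (I A)) (I (K A)) (I (I A)) (I A) ⟩
  I (I A) ⊕ K (I A) ⊕ (I (K A) ⊕ I A) ⊕ (K A ⊕ K A)
    ≡⟨ trans (cong (expanded ⊕_) (⊕-self (K A))) (⊕-identityʳ expanded) ⟩
  I (I A) ⊕ K (I A) ⊕ (I (K A) ⊕ I A)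
    ≡⟨ cong (I (I A) ⊕ K (I A) ⊕_) (sym (I-⊕ (K A) A)) ⟩
  I (I A) ⊕ K (I A) ⊕ I (K A ⊕ A) ∎
  where
  open ≡-Reasoning
  open CommutativeMonoidSolver (⊕-commutativeMonoid n) using (solve; _⊜_) renaming (_⊕_ to _⊞_)
  expanded : Subset n
  expanded = I (I A) ⊕ K (I A) ⊕ (I (K A) ⊕ I A)
  rearrange : (p q r s t : Subset n) →
    p ⊕ q ⊕ (r ⊕ s) ⊕ (p ⊕ t) ≡ s ⊕ q ⊕ (r ⊕ t) ⊕ (p ⊕ p)
  rearrange = solve 5 (λ p q r s t →
    ((p ⊞ q) ⊞ (r ⊞ s)) ⊞ (p ⊞ t) ⊜ ((s ⊞ q) ⊞ (r ⊞ t)) ⊞ (p ⊞ p)) refl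

-- The identity is purely algebraic: w need not be a Gauss code.
proposition5 : (n : ℕ) (w : Zigzag n) → IsGaussCode w → (x : Fin n) →
    bP w ⁅ x ⁆ ≡ iP w (iP w ⁅ x ⁆) ⊕ s w x (iP w ⁅ x ⁆)
proposition5 n w _ x = begin
  bP w X
    ≡⟨ c∼∘c-expansion κ i (extend-⊕ _) (extend-⊕ _) (κP-idempotent w) X ⟩
  i (i X) ⊕ κ (i X) ⊕ i (κ X ⊕ X)
    ≡⟨ cong (λ B → i (i X) ⊕ κ (i X) ⊕ i B) (κP-⁅⁆-⊕ w x) ⟩
  i (i X) ⊕ κ (i X) ⊕ i (white · X)
    ≡⟨ cong (i (i X) ⊕ κ (i X) ⊕_) (extend-· _ white X) ⟩
  i (i X) ⊕ κ (i X) ⊕ white · i X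
    ≡⟨ ⊕-assoc (i (i X)) _ _ ⟩
  i (i X) ⊕ (κ (i X) ⊕ white · i X)
    ≡⟨ cong (i (i X) ⊕_) (sym (s-κP w x (i X))) ⟩
  i (i X) ⊕ s w x (i X) ∎
  where
  open ≡-Reasoning
  X : Subset n
  X = ⁅ x ⁆
  κ i : Subset n → Subset n
  κ = κP w
  i = iP w
  white : Bool
  white = not (black w x)
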